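{- Let $\prec$ be any strict total order on $\mathbb{Z}$, and let $\mathcal{S}_\prec=\{S_\prec(p,q)\}_{p,q\in\mathbb{Z}^2}$ be the system of digital segments derived from $\prec$ (defined in the context). Then $\mathcal{S}_\prec$ is a consistent digital line segments system (CDS).
   Context: Grid graph on $\mathbb{Z}^2$: two points are adjacent iff they differ by $1$ in exactly one coordinate. Derived system $S_\prec$: for $p=(p_x,p_y)$, $q=(q_x,q_y)$, if $p_x>q_x$ swap $p$ and $q$, so assume $p_x\le q_x$. If $p_y\le q_y$, $S_\prec(p,q)$ is the set of points visited by the following walk: start at $p$ and repeatedly step either up (add $(0,1)$) or right (add $(1,0)$) until reaching $q$; when at a point $(x,y)$, step up if $x+y$ is among the $q_y-p_y$ greatest elements, with respect to $\prec$, of the integer interval $[p_x+p_y,\,q_x+q_y-1]$ (the segment interval), and step right otherwise. If $p_y>q_y$, $S_\prec(p,q)$ is defined as the mirror image, under reflection in the $y$-axis $(x,y)\mapsto(-x,y)$, of $S_\prec((-q_x,q_y),(-p_x,p_y))$. A system $\{S(p,q)\}$ with $\{p,q\}\subseteq S(p,q)\subseteq\mathbb{Z}^2$ is a CDS if: (S1) each $S(p,q)$ is the vertex set of a path from $p$ to $q$ in the grid graph; (S2) $S(p,q)=S(q,p)$; (S3) for every $r\in S(p,q)$, $S(p,r)\subseteq S(p,q)$; (S4) for all $p,q$ there is $r\notin S(p,q)$ with $S(p,q)\subseteq S(p,r)$; (S5) if $p,q$ lie on a common horizontal or vertical line then $S(p,q)$ lies on that line. -}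

module Defs where

open import Level using (Level)
open import Data.Bool using (Bool; true; false; if_then_else_)
open import Data.Nat as ℕ using (ℕ; zero; suc)
open import Data.Integer using (ℤ; +_; _+_; _-_; -_; ∣_∣; _≤?_)
open import Data.Product using (_×_; _,_; proj₁; proj₂; ∃-syntax)
open import Data.Sum using (_⊎_)
open import Data.Maybe using (just)
open import Data.List using (List; []; _∷_; map; upTo; filter; length; last)
open import Data.List.Membership.Propositional using (_∈_)
open import Data.List.Relation.Unary.Linked using (Linked)
open import Data.List.Relation.Unary.Unique.Propositional using (Unique)
open import Relation.Nullary using (does; ¬_)
open import Relation.Unary using (Pred; _⊆_)
open import Relation.Binary using (Rel; IsStrictTotalOrder)
open import Relation.Binary.PropositionalEquality using (_≡_)
open import Function.Bundles using (_⇔_)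

Point : Set
Point = ℤ × ℤ

Adj : Point → Point → Set
Adj (x₁ , y₁) (x₂ , y₂) =
  (x₁ ≡ x₂ × ∣ y₁ - y₂ ∣ ≡ 1) ⊎ (y₁ ≡ y₂ × ∣ x₁ - x₂ ∣ ≡ 1)

PSet : Set₁
PSet = Pred Point _

IsPathVertexSet : PSet → Point → Point → Set
IsPathVertexSet A p q =
  ∃[ vs ] (Data.List.head vs ≡ just p) × (last vs ≡ just q)
        × Linked Adj vs × Unique vs × (∀ r → (A r ⇔ r ∈ vs))

mirror : Point → Point
mirror (x , y) = (- x , y)

module Derived {ℓ : Level} {_≺_ : Rel ℤ ℓ} (sto : IsStrictTotalOrder _≡_ _≺_) where
  open IsStrictTotalOrder sto using (_<?_)

  interval : ℤ → ℕ → List ℤ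
  interval a n = map (λ j → a + + j) (upTo n)

  -- t is among the k greatest elements (w.r.t. ≺) of the list I
  -- (I has distinct elements): fewer than k elements of I are ≻ t
  amongGreatest : ℕ → List ℤ → ℤ → Bool
  amongGreatest k I t = does (length (filter (λ s → t <? s) I) ℕ.<? k)

  -- The monotone walk from p to q (intended for p_x ≤ q_x, p_y ≤ q_y).
  -- Segment interval is [p_x+p_y, q_x+q_y-1], of length n below.
  module _ (p q : Point) where
    n : ℕ
    n = ∣ (proj₁ q + proj₂ q) - (proj₁ p + proj₂ p) ∣

    k : ℕ
    k = ∣ proj₂ q - proj₂ p ∣

    segInterval : List ℤ
    segInterval = interval (proj₁ p + proj₂ p) n

    step : Point → Point
    step (x , y) = if amongGreatest k segInterval (x + y)
                   then (x , y + + 1) else (x + + 1 , y)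

    walk : ℕ → Point
    walk zero = p
    walk (suc i) = step (walk i)

    -- points visited by the walk: positions 0..n (it reaches q after n steps)
    Sup : PSet
    Sup r = ∃[ i ] (i ℕ.≤ n × walk i ≡ r)

  -- case p_x ≤ q_x
  Sord : Point → Point → PSet
  Sord p q r =
    if does (proj₂ p ≤? proj₂ q) then Sup p q r
    else Sup (mirror q) (mirror p) (mirror r)

  S : Point → Point → PSet
  S p q = if does (proj₁ p ≤? proj₁ q) then Sord p q else Sord q p

record IsCDS (S : Point → Point → PSet) : Set₁ where
  field
    S0 : ∀ p q → S p q p × S p q q
    S1 : ∀ p q → IsPathVertexSet (S p q) p q
    S2 : ∀ p q r → (S p q r ⇔ S q p r)
    S3 : ∀ p q r → S p q r → S p r ⊆ S p q
    S4 : ∀ p q → ∃[ r ] (¬ S p q r × S p q ⊆ S p r)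
    S5 : ∀ p q → (proj₁ p ≡ proj₁ q → ∀ r → S p q r → proj₁ r ≡ proj₁ p)
               × (proj₂ p ≡ proj₂ q → ∀ r → S p q r → proj₂ r ≡ proj₂ p)

-- For p ≤ q coordinatewise, the walk S(p, q) makes n = ∣q − p∣₁ unit steps and goes up
-- exactly at those steps whose start has its coordinate sum among the k greatest
-- elements (for ≺) of the segment interval I, where k = q_y − p_y.  Since exactly k
-- elements of I are among its k greatest, the walk ends at q.  Ranks restrict well:
-- if J ⊆ I and c elements of J are among the k greatest of I, then an element of J
-- is among the c greatest of J iff it is among the k greatest of I.  Hence the walk
-- between two of its points is the corresponding piece of the walk itself, which
-- gives consistency (S3).  Of the two neighbours up q and right q, one has its walk
-- from p through q (the decision at q only moves from "right" to "up" when k grows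
-- by one), which gives extendability (S4); symmetrically before p.  All other
-- relative positions of p and q reduce to this one by swapping p and q or by the
-- reflection in the y-axis, and the definition's asymmetric treatment of ties is
-- harmless because axis-parallel segments are straight.

module Submission where

open import Defs
open import Level using (Level)
open import Data.Integer using (ℤ)
open import Relation.Binary using (Rel; IsStrictTotalOrder)
open import Relation.Binary.PropositionalEquality using (_≡_)

open import Algebra.Bundles using (AbelianGroup)
open import Data.Bool using (Bool; true; false; if_then_else_)
open import Data.Integer as ℤ using (+_; -_; _+_; _-_; ∣_∣)
import Data.Integer.Properties as ℤ
open import Data.Integer.Tactic.RingSolver using (solve-∀)
open import Data.List using (List; []; _∷_; _++_; _∷ʳ_; length; filter; last; applyUpTo)
open import Data.List.Membership.Propositional using (_∈_)
open import Data.List.Membership.Propositional.Properties using (∈-applyUpTo⁺; ∈-applyUpTo⁻)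
open import Data.List.Properties
  using (filter-all; filter-none; filter-notAll; filter-++; length-++; length-applyUpTo; applyUpTo-∷ʳ; map-upTo)
open import Data.List.Relation.Unary.All as All using ()
open import Data.List.Relation.Unary.AllPairs using (_∷_)
import Data.List.Relation.Unary.Any as Any
open import Data.List.Relation.Unary.Any using (here; there)
open import Data.List.Relation.Unary.Linked using (Linked; [-]; _∷_)
open import Data.List.Relation.Unary.Unique.Propositional using (Unique)
open import Data.List.Relation.Unary.Unique.Propositional.Properties using (applyUpTo⁺₁)
open import Data.Maybe using (just)
open import Data.Nat as ℕ using (ℕ; zero; suc; z≤n; s≤s)
import Data.Nat.Properties as ℕ
open import Data.Product using (_×_; _,_; proj₁; proj₂; ∃-syntax)
open import Data.Sum using (_⊎_; inj₁; inj₂; [_,_])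
open import Function using (_∘_)
open import Function.Bundles using (_⇔_; mk⇔; Equivalence)
open import Function.Properties.Equivalence using () renaming (trans to ⇔-trans; sym to ⇔-sym)
open import Relation.Binary using (tri<; tri≈; tri>)
open import Relation.Binary.PropositionalEquality using (refl; sym; trans; cong; cong₂; subst; subst₂)
open import Relation.Nullary using (Dec; yes; no; does; ¬_; contradiction)
open import Relation.Nullary.Decidable using (does-⇔; dec-true; dec-false)
open import Relation.Unary as U using (Pred; _⊆_)
open import Algebra.Properties.Group (AbelianGroup.group ℤ.+-0-abelianGroup) using ()
  renaming (∙-cancelʳ to +-cancelʳ)
open Relation.Binary.PropositionalEquality.≡-Reasoning

-- Counting and ranks

count : ∀ {a p} {A : Set a} {P : Pred A p} → U.Decidable P → List A → ℕ
count P? xs = length (filter P? xs)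

count-++ : ∀ {a p} {A : Set a} {P : Pred A p} (P? : U.Decidable P) xs ys →
           count P? (xs ++ ys) ≡ count P? xs ℕ.+ count P? ys
count-++ P? xs ys = trans (cong length (filter-++ P? xs ys)) (length-++ (filter P? xs))

module _ {a p q} {A : Set a} {P : Pred A p} {Q : Pred A q}
         (P? : U.Decidable P) (Q? : U.Decidable Q) where

  count-mono : ∀ xs → (∀ {x} → x ∈ xs → P x → Q x) → count P? xs ℕ.≤ count Q? xs
  count-mono [] P⇒Q = z≤n
  count-mono (x ∷ xs) P⇒Q with P? x | Q? x
  ... | yes px | yes _  = s≤s (count-mono xs (P⇒Q ∘ there))
  ... | yes px | no ¬qx = contradiction (P⇒Q (here refl) px) ¬qx
  ... | no _   | yes _  = ℕ.m≤n⇒m≤1+n (count-mono xs (P⇒Q ∘ there))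
  ... | no _   | no _   = count-mono xs (P⇒Q ∘ there)

  count-strict : ∀ {xs t} → (∀ {x} → x ∈ xs → P x → Q x) →
                 t ∈ xs → Q t → ¬ P t → count P? xs ℕ.< count Q? xs
  count-strict {x ∷ xs} P⇒Q (here refl) qt ¬pt with P? x | Q? x
  ... | yes pt | _      = contradiction pt ¬pt
  ... | no _   | yes _  = s≤s (count-mono xs (P⇒Q ∘ there))
  ... | no _   | no ¬qt = contradiction qt ¬qt
  count-strict {x ∷ xs} P⇒Q (there t∈) qt ¬pt with P? x | Q? x
  ... | yes _  | yes _  = s≤s (count-strict (P⇒Q ∘ there) t∈ qt ¬pt)
  ... | yes px | no ¬qx = contradiction (P⇒Q (here refl) px) ¬qx
  ... | no _   | yes _  = ℕ.m≤n⇒m≤1+n (count-strict (P⇒Q ∘ there) t∈ qt ¬pt)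
  ... | no _   | no _   = count-strict (P⇒Q ∘ there) t∈ qt ¬pt

  count-≤-suc : ∀ {r} {R : Pred A r} {xs} → Unique xs →
                (∀ {x} → x ∈ xs → P x → Q x ⊎ R x) →
                (∀ {x y} → x ∈ xs → y ∈ xs → R x → R y → x ≡ y) →
                count P? xs ℕ.≤ suc (count Q? xs)
  count-≤-suc {xs = []} _ _ _ = z≤n
  count-≤-suc {xs = x ∷ xs} (x∉xs ∷ u) P⇒Q⊎R R-unique with P? x | Q? x
  ... | no _  | yes _  = ℕ.m≤n⇒m≤1+n (count-≤-suc u (P⇒Q⊎R ∘ there) (λ x∈ y∈ → R-unique (there x∈) (there y∈)))
  ... | no _  | no _   = count-≤-suc u (P⇒Q⊎R ∘ there) (λ x∈ y∈ → R-unique (there x∈) (there y∈))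
  ... | yes _ | yes _  = s≤s (count-≤-suc u (P⇒Q⊎R ∘ there) (λ x∈ y∈ → R-unique (there x∈) (there y∈)))
  ... | yes px | no ¬qx = s≤s (count-mono xs P⇒Q)
    where
    rx = [ (λ qx → contradiction qx ¬qx) , (λ rx → rx) ] (P⇒Q⊎R (here refl) px)
    P⇒Q : ∀ {y} → y ∈ xs → P y → Q y
    P⇒Q {y} y∈ py with P⇒Q⊎R (there y∈) py
    ... | inj₁ qy = qy
    ... | inj₂ ry = contradiction (R-unique (here refl) (there y∈) rx ry) (All.lookup x∉xs y∈)

unit-steps⇒≡id : (c : ℕ → ℕ) → c 0 ≡ 0 → (∀ k → c (suc k) ℕ.≤ suc (c k)) →
                 ∀ {m} → c m ≡ m → ∀ {k} → k ℕ.≤ m → c k ≡ k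
unit-steps⇒≡id c c0 step {m} cm {k} k≤m = ℕ.≤-antisym (c≤id k) k≤ck
  where
  c≤id : ∀ k → c k ℕ.≤ k
  c≤id zero    = ℕ.≤-reflexive c0
  c≤id (suc k) = ℕ.≤-trans (step k) (s≤s (c≤id k))
  c[k+d]≤ : ∀ d → c (k ℕ.+ d) ℕ.≤ c k ℕ.+ d
  c[k+d]≤ zero    rewrite ℕ.+-identityʳ k | ℕ.+-identityʳ (c k) = ℕ.≤-refl
  c[k+d]≤ (suc d) rewrite ℕ.+-suc k d | ℕ.+-suc (c k) d = ℕ.≤-trans (step (k ℕ.+ d)) (s≤s (c[k+d]≤ d))
  k≤ck : k ℕ.≤ c k
  k≤ck = ℕ.+-cancelʳ-≤ (m ℕ.∸ k) k (c k) (ℕ.≤-trans (ℕ.≤-reflexive k+d≡c[k+d]) (c[k+d]≤ (m ℕ.∸ k)))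
    where
    k+d≡c[k+d] : k ℕ.+ (m ℕ.∸ k) ≡ c (k ℕ.+ (m ℕ.∸ k))
    k+d≡c[k+d] = trans (ℕ.m+[n∸m]≡n k≤m) (trans (sym cm) (cong c (sym (ℕ.m+[n∸m]≡n k≤m))))

monotone-by-steps : (h : ℕ → ℕ) → (∀ i → h i ℕ.≤ h (suc i)) → ∀ {i j} → i ℕ.≤ j → h i ℕ.≤ h j
monotone-by-steps h step {j = zero}  z≤n = ℕ.≤-refl
monotone-by-steps h step {i} {suc j} i≤1+j with ℕ.m≤n⇒m<n∨m≡n i≤1+j
... | inj₁ i<1+j = ℕ.≤-trans (monotone-by-steps h step (ℕ.≤-pred i<1+j)) (step j)
... | inj₂ refl  = ℕ.≤-refl

module Ranking {a ℓ} {A : Set a} {_≺_ : Rel A ℓ} (sto : IsStrictTotalOrder _≡_ _≺_) where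
  open IsStrictTotalOrder sto using (_<?_; compare; irrefl) renaming (trans to ≺-trans)

  rank : List A → A → ℕ
  rank I t = count (t <?_) I

  Top : ℕ → List A → Pred A _
  Top K I t = rank I t ℕ.< K

  top? : ∀ K I → U.Decidable (Top K I)
  top? K I t = rank I t ℕ.<? K

  rank-antitone : ∀ I {s t} → s ≺ t → rank I t ℕ.≤ rank I s
  rank-antitone I s≺t = count-mono (_ <?_) (_ <?_) I (λ _ → ≺-trans s≺t)

  rank-strict : ∀ I {s t} → s ∈ I → t ≺ s → rank I s ℕ.< rank I t
  rank-strict I s∈I t≺s = count-strict (_ <?_) (_ <?_) (λ _ → ≺-trans t≺s) s∈I t≺s (irrefl refl)

  rank-<⇒≻ : ∀ I {s t} → rank I s ℕ.< rank I t → t ≺ s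
  rank-<⇒≻ I {s} {t} r<r with compare t s
  ... | tri< t≺s _ _ = t≺s
  ... | tri≈ _ refl _ = contradiction r<r (ℕ.<-irrefl refl)
  ... | tri> _ _ s≺t = contradiction (rank-antitone I s≺t) (ℕ.<⇒≱ r<r)

  rank-injective : ∀ I {s t} → s ∈ I → t ∈ I → rank I s ≡ rank I t → s ≡ t
  rank-injective I {s} {t} s∈I t∈I r≡r with compare t s
  ... | tri< t≺s _ _ = contradiction r≡r (ℕ.<⇒≢ (rank-strict I s∈I t≺s))
  ... | tri≈ _ t≡s _ = sym t≡s
  ... | tri> _ _ s≺t = contradiction (sym r≡r) (ℕ.<⇒≢ (rank-strict I t∈I s≺t))

  rank<length : ∀ I {t} → t ∈ I → rank I t ℕ.< length I
  rank<length I t∈I = filter-notAll (_ <?_) I (Any.map (λ { refl → irrefl refl }) t∈I)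

  count-Top : ∀ I → Unique I → ∀ {K} → K ℕ.≤ length I → count (top? K I) I ≡ K
  count-Top I uniq = unit-steps⇒≡id (λ K → count (top? K I) I) count-Top-zero count-Top-suc count-Top-length
    where
    count-Top-zero : count (top? 0 I) I ≡ 0
    count-Top-zero = cong length (filter-none (top? 0 I) {I} (All.tabulate (λ _ ())))
    count-Top-length : count (top? (length I) I) I ≡ length I
    count-Top-length = cong length (filter-all (top? (length I) I) {I} (All.tabulate (rank<length I)))
    count-Top-suc : ∀ K → count (top? (suc K) I) I ℕ.≤ suc (count (top? K I) I)
    count-Top-suc K = count-≤-suc (top? (suc K) I) (top? K I) {R = λ x → rank I x ≡ K} uniq
      (λ _ r<1+K → ℕ.m≤n⇒m<n∨m≡n (ℕ.≤-pred r<1+K))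
      (λ x∈I y∈I rx≡K ry≡K → rank-injective I x∈I y∈I (trans rx≡K (sym ry≡K)))

  Top-restrict : ∀ K I J {t} → t ∈ J → Top (count (top? K I) J) J t ⇔ Top K I t
  Top-restrict K I J {t} t∈J = mk⇔ to from
    where
    to : Top (count (top? K I) J) J t → Top K I t
    to topJ = ℕ.≰⇒> λ K≤rank → ℕ.<⇒≱ topJ
      (count-mono (top? K I) (t <?_) J (λ _ x-top → rank-<⇒≻ I (ℕ.<-≤-trans x-top K≤rank)))
    from : Top K I t → Top (count (top? K I) J) J t
    from topI = count-strict (t <?_) (top? K I)
      (λ _ t≺x → ℕ.≤-<-trans (rank-antitone I t≺x) topI) t∈J topI (irrefl refl)

  Top-suc⊎¬Top : ∀ K J t → Top (suc K) J t ⊎ ¬ Top K J t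
  Top-suc⊎¬Top K J t with top? (suc K) J t
  ... | yes top = inj₁ top
  ... | no ¬top = inj₂ (¬top ∘ ℕ.m≤n⇒m≤1+n)

-- Integer intervals

[x+y]-x≡y : ∀ x y → (x + y) - x ≡ y
[x+y]-x≡y = solve-∀

∣[x+m]-x∣≡m : ∀ x m → ∣ (x + + m) - x ∣ ≡ m
∣[x+m]-x∣≡m x m = cong ∣_∣ ([x+y]-x≡y x (+ m))

∣[x+m]-[x+k]∣≡m∸k : ∀ x {m k} → k ℕ.≤ m → ∣ (x + + m) - (x + + k) ∣ ≡ m ℕ.∸ k
∣[x+m]-[x+k]∣≡m∸k x {m} {k} k≤m = cong ∣_∣ (begin
  (x + + m) - (x + + k) ≡⟨ cancel x (+ m) (+ k) ⟩
  + m - + k             ≡⟨ ℤ.m-n≡m⊖n m k ⟩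
  m ℤ.⊖ k               ≡⟨ ℤ.⊖-≥ k≤m ⟩
  + (m ℕ.∸ k)           ∎)
  where
  cancel : ∀ x y z → (x + y) - (x + z) ≡ y - z
  cancel = solve-∀

x+m≡x+k⇒m≡k : ∀ x {m k} → x + + m ≡ x + + k → m ≡ k
x+m≡x+k⇒m≡k x {m} {k} eq = begin
  m                     ≡⟨ ∣[x+m]-x∣≡m x m ⟨
  ∣ (x + + m) - x ∣     ≡⟨ cong (λ z → ∣ z - x ∣) eq ⟩
  ∣ (x + + k) - x ∣     ≡⟨ ∣[x+m]-x∣≡m x k ⟩
  k                     ∎

x≡x+m⇒m≡0 : ∀ x {m} → x ≡ x + + m → m ≡ 0
x≡x+m⇒m≡0 x eq = sym (x+m≡x+k⇒m≡k x (trans (ℤ.+-identityʳ x) eq))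

x≤y⇒y≡x+∣y-x∣ : ∀ {x y} → x ℤ.≤ y → y ≡ x + + ∣ y - x ∣
x≤y⇒y≡x+∣y-x∣ {x} {y} x≤y = begin
  y                 ≡⟨ x+[y-x]≡y x y ⟨
  x + (y - x)       ≡⟨ cong (λ z → x + z) (ℤ.0≤i⇒+∣i∣≡i (ℤ.i≤j⇒0≤j-i x≤y)) ⟨
  x + + ∣ y - x ∣   ∎
  where
  x+[y-x]≡y : ∀ x y → x + (y - x) ≡ y
  x+[y-x]≡y = solve-∀

+-+-assoc : ∀ x m k → (x + + m) + + k ≡ x + + (m ℕ.+ k)
+-+-assoc x m k = trans (ℤ.+-assoc x (+ m) (+ k)) (cong (λ z → x + z) (sym (ℤ.pos-+ m k)))

x+m+1≡x+[1+m] : ∀ x m → (x + + m) + + 1 ≡ x + + suc m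
x+m+1≡x+[1+m] x m = trans (+-+-assoc x m 1) (cong (λ k → x + + k) (ℕ.+-comm m 1))

x-1+[1+m]≡x+m : ∀ x m → (x - + 1) + + suc m ≡ x + + m
x-1+[1+m]≡x+m x m = trans (cong (λ z → (x - + 1) + z) (ℤ.pos-+ 1 m)) (x-a+[a+b]≡x+b x (+ 1) (+ m))
  where
  x-a+[a+b]≡x+b : ∀ x a b → (x - a) + (a + b) ≡ x + b
  x-a+[a+b]≡x+b = solve-∀

x-1+1≡x : ∀ x → (x - + 1) + + 1 ≡ x
x-1+1≡x x = trans (x-1+[1+m]≡x+m x 0) (ℤ.+-identityʳ x)

range : ℤ → ℕ → List ℤ
range a n = applyUpTo (λ j → a + + j) n

applyUpTo-+ : ∀ {a} {X : Set a} (f : ℕ → X) i j →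
              applyUpTo f (i ℕ.+ j) ≡ applyUpTo f i ++ applyUpTo (λ k → f (i ℕ.+ k)) j
applyUpTo-+ f zero    j = refl
applyUpTo-+ f (suc i) j = cong (f 0 ∷_) (applyUpTo-+ (f ∘ suc) i j)

applyUpTo-cong : ∀ {a} {X : Set a} {f g : ℕ → X} n → (∀ j → f j ≡ g j) → applyUpTo f n ≡ applyUpTo g n
applyUpTo-cong zero    _   = refl
applyUpTo-cong (suc n) f≗g = cong₂ _∷_ (f≗g 0) (applyUpTo-cong n (f≗g ∘ suc))

range-++ : ∀ a i j → range a (i ℕ.+ j) ≡ range a i ++ range (a + + i) j
range-++ a i j = trans (applyUpTo-+ _ i j) (cong (range a i ++_) (applyUpTo-cong j λ k → sym (+-+-assoc a i k)))

∈-range : ∀ a {j n} → j ℕ.< n → a + + j ∈ range a n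
∈-range a = ∈-applyUpTo⁺ (λ j → a + + j)

range-unique : ∀ a n → Unique (range a n)
range-unique a n = applyUpTo⁺₁ _ n (λ i<j _ eq → ℕ.<⇒≢ i<j (x+m≡x+k⇒m≡k a eq))

length-range : ∀ a n → length (range a n) ≡ n
length-range a = length-applyUpTo _

-- Lattice points

infixl 6 _⊞_
infix 4 _≼_

_⊞_ : Point → ℕ × ℕ → Point
(x , y) ⊞ (i , j) = (x + + i , y + + j)

sum : Point → ℤ
sum p = proj₁ p + proj₂ p

_≼_ : Point → Point → Set
p ≼ q = proj₁ p ℤ.≤ proj₁ q × proj₂ p ℤ.≤ proj₂ q

sum-⊞ : ∀ p i j → sum (p ⊞ (i , j)) ≡ sum p + + (i ℕ.+ j)
sum-⊞ (x , y) i j = trans (shuffle x y (+ i) (+ j)) (cong (λ z → (x + y) + z) (sym (ℤ.pos-+ i j)))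
  where
  shuffle : ∀ x y i j → (x + i) + (y + j) ≡ (x + y) + (i + j)
  shuffle = solve-∀

≼-⊞ : ∀ p d → p ≼ p ⊞ d
≼-⊞ (x , y) (i , j) = ℤ.i≤i+j x (+ i) , ℤ.i≤i+j y (+ j)

≼⇒≡⊞ : ∀ {p q} → p ≼ q → ∃[ d ] q ≡ p ⊞ d
≼⇒≡⊞ (x≤x′ , y≤y′) = _ , cong₂ _,_ (x≤y⇒y≡x+∣y-x∣ x≤x′) (x≤y⇒y≡x+∣y-x∣ y≤y′)

⊞-mono-≼ : ∀ p {i i′ j j′} → i ℕ.≤ i′ → j ℕ.≤ j′ → p ⊞ (i , j) ≼ p ⊞ (i′ , j′)
⊞-mono-≼ (x , y) i≤i′ j≤j′ = ℤ.+-monoʳ-≤ x (ℤ.+≤+ i≤i′) , ℤ.+-monoʳ-≤ y (ℤ.+≤+ j≤j′)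

mirror-involutive : ∀ p → mirror (mirror p) ≡ p
mirror-involutive (x , y) = cong (_, y) (ℤ.neg-involutive x)

mirror-injective : ∀ {u v} → mirror u ≡ mirror v → u ≡ v
mirror-injective {u} {v} eq = trans (sym (mirror-involutive u)) (trans (cong mirror eq) (mirror-involutive v))

⊞-identityʳ : ∀ p → p ⊞ (0 , 0) ≡ p
⊞-identityʳ (x , y) = cong₂ _,_ (ℤ.+-identityʳ x) (ℤ.+-identityʳ y)

mirror-⊞-vertical : ∀ p l → mirror (p ⊞ (0 , l)) ≡ mirror p ⊞ (0 , l)
mirror-⊞-vertical (x , y) l = cong (_, y + + l) (trans (cong -_ (ℤ.+-identityʳ x)) (sym (ℤ.+-identityʳ (- x))))

mirror-⊞-horizontal : ∀ p {l l′ m} → l ℕ.+ l′ ≡ m → mirror (p ⊞ (l′ , 0)) ≡ mirror (p ⊞ (m , 0)) ⊞ (l , 0)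
mirror-⊞-horizontal (x , y) {l} {l′} refl = cong₂ _,_
  (trans (-[x+b]≡-[x+[a+b]]+a x (+ l) (+ l′)) (cong (λ z → - (x + z) + + l) (sym (ℤ.pos-+ l l′))))
  (sym (ℤ.+-identityʳ (y + + 0)))
  where
  -[x+b]≡-[x+[a+b]]+a : ∀ x a b → - (x + b) ≡ - (x + (a + b)) + a
  -[x+b]≡-[x+[a+b]]+a = solve-∀

up right : Point → Point
up (x , y) = (x , y + + 1)
right (x , y) = (x + + 1 , y)

up-injective : ∀ {p q} → up p ≡ up q → p ≡ q
up-injective eq = cong₂ _,_ (cong proj₁ eq) (+-cancelʳ (+ 1) _ _ (cong proj₂ eq))

right-injective : ∀ {p q} → right p ≡ right q → p ≡ q
right-injective eq = cong₂ _,_ (+-cancelʳ (+ 1) _ _ (cong proj₁ eq)) (cong proj₂ eq)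

down left : Point → Point
down (x , y) = (x , y - + 1)
left (x , y) = (x - + 1 , y)

up-⊞ : ∀ p i j → up (p ⊞ (i , j)) ≡ p ⊞ (i , suc j)
up-⊞ (x , y) i j = cong (x + + i ,_) (x+m+1≡x+[1+m] y j)

right-⊞ : ∀ p i j → right (p ⊞ (i , j)) ≡ p ⊞ (suc i , j)
right-⊞ (x , y) i j = cong (_, y + + j) (x+m+1≡x+[1+m] x i)

up-down : ∀ p → up (down p) ≡ p
up-down (x , y) = cong (x ,_) (x-1+1≡x y)

right-left : ∀ p → right (left p) ≡ p
right-left (x , y) = cong (_, y) (x-1+1≡x x)

down-⊞ : ∀ p i j → down p ⊞ (i , suc j) ≡ p ⊞ (i , j)
down-⊞ (x , y) i j = cong (x + + i ,_) (x-1+[1+m]≡x+m y j)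

left-⊞ : ∀ p i j → left p ⊞ (suc i , j) ≡ p ⊞ (i , j)
left-⊞ (x , y) i j = cong (_, y + + j) (x-1+[1+m]≡x+m x i)

sum-up : ∀ p → sum (up p) ≡ sum p + + 1
sum-up (x , y) = sym (ℤ.+-assoc x y (+ 1))

sum-right : ∀ p → sum (right p) ≡ sum p + + 1
sum-right (x , y) = x+1+y≡x+y+1 x y (+ 1)
  where
  x+1+y≡x+y+1 : ∀ x y o → (x + o) + y ≡ (x + y) + o
  x+1+y≡x+y+1 = solve-∀

sum-down≡sum-left : ∀ p → sum (down p) ≡ sum (left p)
sum-down≡sum-left (x , y) = x+[y-1]≡[x-1]+y x y
  where
  x+[y-1]≡[x-1]+y : ∀ x y → x + (y - + 1) ≡ (x - + 1) + y
  x+[y-1]≡[x-1]+y = solve-∀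

Adj-up : ∀ p → Adj p (up p)
Adj-up (x , y) = inj₁ (refl , trans (ℤ.∣i-j∣≡∣j-i∣ y (y + + 1)) (∣[x+m]-x∣≡m y 1))

Adj-right : ∀ p → Adj p (right p)
Adj-right (x , y) = inj₂ (refl , trans (ℤ.∣i-j∣≡∣j-i∣ x (x + + 1)) (∣[x+m]-x∣≡m x 1))

Adj-sym : ∀ {p q} → Adj p q → Adj q p
Adj-sym {p} {q} (inj₁ (x≡ , d)) = inj₁ (sym x≡ , trans (ℤ.∣i-j∣≡∣j-i∣ (proj₂ q) (proj₂ p)) d)
Adj-sym {p} {q} (inj₂ (y≡ , d)) = inj₂ (sym y≡ , trans (ℤ.∣i-j∣≡∣j-i∣ (proj₁ q) (proj₁ p)) d)

Adj-mirror : ∀ {p q} → Adj p q → Adj (mirror p) (mirror q)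
Adj-mirror         (inj₁ (x≡ , d)) = inj₁ (cong -_ x≡ , d)
Adj-mirror {p} {q} (inj₂ (y≡ , d)) = inj₂ (y≡ , trans (cong ∣_∣ (-x-[-y]≡-[x-y] (proj₁ p) (proj₁ q)))
                                                     (trans (ℤ.∣-i∣≡∣i∣ (proj₁ p - proj₁ q)) d))
  where
  -x-[-y]≡-[x-y] : ∀ x y → - x - - y ≡ - (x - y)
  -x-[-y]≡-[x-y] = solve-∀

data Orientation (p q : Point) : Set where
  ↗ : p ≼ q → Orientation p q
  ↙ : q ≼ p → Orientation p q
  ↖ : mirror p ≼ mirror q → Orientation p q
  ↘ : mirror q ≼ mirror p → Orientation p q

orientation : ∀ p q → Orientation p q
orientation p q with ℤ.≤-total (proj₁ p) (proj₁ q) | ℤ.≤-total (proj₂ p) (proj₂ q)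
... | inj₁ px≤qx | inj₁ py≤qy = ↗ (px≤qx , py≤qy)
... | inj₂ qx≤px | inj₂ qy≤py = ↙ (qx≤px , qy≤py)
... | inj₂ qx≤px | inj₁ py≤qy = ↖ (ℤ.neg-mono-≤ qx≤px , py≤qy)
... | inj₁ px≤qx | inj₂ qy≤py = ↘ (ℤ.neg-mono-≤ px≤qx , qy≤py)

Between : ℤ → ℤ → ℤ → Set
Between a b x = (a ℤ.≤ x × x ℤ.≤ b) ⊎ (b ℤ.≤ x × x ℤ.≤ a)

Between-neg : ∀ {a b x} → Between (- a) (- b) (- x) → Between a b x
Between-neg (inj₁ (-a≤-x , -x≤-b)) = inj₂ (ℤ.neg-cancel-≤ -x≤-b , ℤ.neg-cancel-≤ -a≤-x)
Between-neg (inj₂ (-b≤-x , -x≤-a)) = inj₁ (ℤ.neg-cancel-≤ -x≤-a , ℤ.neg-cancel-≤ -b≤-x)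

Between-≡ : ∀ {a b x} → Between a b x → a ≡ b → x ≡ a
Between-≡ (inj₁ (a≤x , x≤b)) refl = ℤ.≤-antisym x≤b a≤x
Between-≡ (inj₂ (b≤x , x≤a)) refl = ℤ.≤-antisym x≤a b≤x

-- Staircase walks

stairs : Point → (ℕ → Bool) → ℕ → Point
stairs s f zero    = s
stairs s f (suc i) = if f i then up (stairs s f i) else right (stairs s f i)

stairs-up : ∀ s f {i} → f i ≡ true → stairs s f (suc i) ≡ up (stairs s f i)
stairs-up s f eq rewrite eq = refl

stairs-right : ∀ s f {i} → f i ≡ false → stairs s f (suc i) ≡ right (stairs s f i)
stairs-right s f eq rewrite eq = refl

ups rights : (ℕ → Bool) → ℕ → ℕ
ups f zero       = 0
ups f (suc i)    = if f i then suc (ups f i) else ups f i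
rights f zero    = 0
rights f (suc i) = if f i then rights f i else suc (rights f i)

stairs-⊞ : ∀ s f i → stairs s f i ≡ s ⊞ (rights f i , ups f i)
stairs-⊞ s f zero = sym (cong₂ _,_ (ℤ.+-identityʳ _) (ℤ.+-identityʳ _))
stairs-⊞ s f (suc i) with f i
... | true  = trans (cong up (stairs-⊞ s f i)) (cong (proj₁ s + + rights f i ,_) (x+m+1≡x+[1+m] (proj₂ s) (ups f i)))
... | false = trans (cong right (stairs-⊞ s f i)) (cong (_, proj₂ s + + ups f i) (x+m+1≡x+[1+m] (proj₁ s) (rights f i)))

rights+ups : ∀ f i → rights f i ℕ.+ ups f i ≡ i
rights+ups f zero = refl
rights+ups f (suc i) with f i
... | true  = trans (ℕ.+-suc (rights f i) (ups f i)) (cong suc (rights+ups f i))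
... | false = cong suc (rights+ups f i)

sum-stairs : ∀ s f i → sum (stairs s f i) ≡ sum s + + i
sum-stairs s f i = begin
  sum (stairs s f i)                           ≡⟨ cong sum (stairs-⊞ s f i) ⟩
  sum (s ⊞ (rights f i , ups f i))             ≡⟨ sum-⊞ s (rights f i) (ups f i) ⟩
  sum s + + (rights f i ℕ.+ ups f i)           ≡⟨ cong (λ k → sum s + + k) (rights+ups f i) ⟩
  sum s + + i                                  ∎

stairs-injective : ∀ s f {i j} → stairs s f i ≡ stairs s f j → i ≡ j
stairs-injective s f {i} {j} eq =
  x+m≡x+k⇒m≡k (sum s) (trans (sym (sum-stairs s f i)) (trans (cong sum eq) (sum-stairs s f j)))

stairs-shift : ∀ s f g i l → (∀ {j} → j ℕ.< l → g j ≡ f (i ℕ.+ j)) →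
               stairs (stairs s f i) g l ≡ stairs s f (i ℕ.+ l)
stairs-shift s f g i zero    _   = cong (stairs s f) (sym (ℕ.+-identityʳ i))
stairs-shift s f g i (suc l) g≗f = trans
  (cong₂ (λ b w → if b then up w else right w) (g≗f ℕ.≤-refl) (stairs-shift s f g i l (g≗f ∘ ℕ.m≤n⇒m≤1+n)))
  (cong (stairs s f) (sym (ℕ.+-suc i l)))

ups-step : ∀ f i → ups f (suc i) ℕ.≤ suc (ups f i)
ups-step f i with f i
... | true  = ℕ.≤-refl
... | false = ℕ.n≤1+n _

rights-step : ∀ f i → rights f (suc i) ℕ.≤ suc (rights f i)
rights-step f i with f i
... | true  = ℕ.n≤1+n _
... | false = ℕ.≤-refl

ups-mono : ∀ f {i j} → i ℕ.≤ j → ups f i ℕ.≤ ups f j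
ups-mono f = monotone-by-steps (ups f) ups-increasing
  where
  ups-increasing : ∀ i → ups f i ℕ.≤ ups f (suc i)
  ups-increasing i with f i
  ... | true  = ℕ.n≤1+n _
  ... | false = ℕ.≤-refl

rights-mono : ∀ f {i j} → i ℕ.≤ j → rights f i ℕ.≤ rights f j
rights-mono f = monotone-by-steps (rights f) rights-increasing
  where
  rights-increasing : ∀ i → rights f i ℕ.≤ rights f (suc i)
  rights-increasing i with f i
  ... | true  = ℕ.≤-refl
  ... | false = ℕ.n≤1+n _

ups-cong : ∀ {f g} → (∀ j → f j ≡ g j) → ∀ i → ups f i ≡ ups g i
ups-cong f≗g zero    = refl
ups-cong f≗g (suc i) = cong₂ (λ b u → if b then suc u else u) (f≗g i) (ups-cong f≗g i)

ups-count : ∀ {p} {P : Pred ℤ p} (P? : U.Decidable P) a i →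
            ups (λ j → does (P? (a + + j))) i ≡ count P? (range a i)
ups-count P? a zero    = refl
ups-count P? a (suc i) = begin
  ups f (suc i)                                   ≡⟨ ups-last ⟩
  ups f i ℕ.+ count P? (a + + i ∷ [])             ≡⟨ cong (ℕ._+ count P? (a + + i ∷ [])) (ups-count P? a i) ⟩
  count P? (range a i) ℕ.+ count P? (a + + i ∷ []) ≡⟨ count-++ P? (range a i) _ ⟨
  count P? (range a i ∷ʳ (a + + i))               ≡⟨ cong (count P?) (applyUpTo-∷ʳ _ i) ⟩
  count P? (range a (suc i))                      ∎
  where
  f = λ j → does (P? (a + + j))
  ups-last : ups f (suc i) ≡ ups f i ℕ.+ count P? (a + + i ∷ [])
  ups-last with P? (a + + i)
  ... | yes _ = ℕ.+-comm 1 (ups f i)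
  ... | no _  = sym (ℕ.+-identityʳ _)

stairs-adjacent : ∀ s f i → Adj (stairs s f i) (stairs s f (suc i))
stairs-adjacent s f i with f i
... | true  = Adj-up _
... | false = Adj-right _

-- Grid paths

record IndexedPath (A : PSet) (p q : Point) : Set where
  field
    len       : ℕ
    at        : ℕ → Point
    at-0      : at 0 ≡ p
    at-len    : at len ≡ q
    adjacent  : ∀ {i} → i ℕ.< len → Adj (at i) (at (suc i))
    injective : ∀ {i j} → i ℕ.≤ len → j ℕ.≤ len → at i ≡ at j → i ≡ j
    vertices  : ∀ r → A r ⇔ (∃[ i ] (i ℕ.≤ len × at i ≡ r))

last-applyUpTo : ∀ {a} {X : Set a} (f : ℕ → X) n → last (applyUpTo f (suc n)) ≡ just (f n)
last-applyUpTo f zero    = refl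
last-applyUpTo f (suc n) = last-applyUpTo (f ∘ suc) n

linked-applyUpTo : ∀ {a r} {X : Set a} {R : X → X → Set r} (f : ℕ → X) n →
                   (∀ {i} → i ℕ.< n → R (f i) (f (suc i))) → Linked R (applyUpTo f (suc n))
linked-applyUpTo f zero    _    = [-]
linked-applyUpTo f (suc n) step = step (s≤s z≤n) ∷ linked-applyUpTo (f ∘ suc) n (step ∘ s≤s)

IndexedPath⇒IsPathVertexSet : ∀ {A p q} → IndexedPath A p q → IsPathVertexSet A p q
IndexedPath⇒IsPathVertexSet {A} {p} {q} path =
  vs , cong just at-0 , trans (last-applyUpTo at len) (cong just at-len) ,
  linked-applyUpTo at len adjacent ,
  applyUpTo⁺₁ at (suc len) (λ i<j j<1+len → ℕ.<⇒≢ i<j ∘ injective (ℕ.<⇒≤ (ℕ.<-≤-trans i<j (ℕ.≤-pred j<1+len))) (ℕ.≤-pred j<1+len)) ,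
  λ r → mk⇔ (λ Ar → let (i , i≤len , at-i≡r) = Equivalence.to (vertices r) Ar
                    in subst (_∈ vs) at-i≡r (∈-applyUpTo⁺ at (s≤s i≤len)))
            (λ r∈vs → let (i , i<1+len , r≡at-i) = ∈-applyUpTo⁻ at r∈vs
                      in Equivalence.from (vertices r) (i , ℕ.≤-pred i<1+len , sym r≡at-i))
  where
  open IndexedPath path
  vs = applyUpTo at (suc len)

reverse-path : ∀ {A p q} → IndexedPath A p q → IndexedPath A q p
reverse-path {A} path = record
  { len       = len
  ; at        = λ i → at (len ℕ.∸ i)
  ; at-0      = at-len
  ; at-len    = trans (cong at (ℕ.n∸n≡0 len)) at-0
  ; adjacent  = λ {i} i<len → subst (λ k → Adj (at k) (at (len ℕ.∸ suc i))) (sym (ℕ.+-∸-assoc 1 i<len))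
                  (Adj-sym (adjacent (ℕ.<-≤-trans (ℕ.∸-monoʳ-< ℕ.≤-refl i<len) (ℕ.m∸n≤m len i))))
  ; injective = λ {i} {j} i≤len j≤len eq → ℕ.∸-cancelˡ-≡ i≤len j≤len (injective (ℕ.m∸n≤m len i) (ℕ.m∸n≤m len j) eq)
  ; vertices  = λ r → mk⇔
      (λ Ar → let (i , i≤len , at-i≡r) = Equivalence.to (vertices r) Ar
              in len ℕ.∸ i , ℕ.m∸n≤m len i , trans (cong at (ℕ.m∸[m∸n]≡n i≤len)) at-i≡r)
      (λ (i , _ , at≡r) → Equivalence.from (vertices r) (len ℕ.∸ i , ℕ.m∸n≤m len i , at≡r))
  }
  where open IndexedPath path

mirror-path : ∀ {A p q} → IndexedPath A p q → IndexedPath (A ∘ mirror) (mirror p) (mirror q)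
mirror-path {A} path = record
  { len       = len
  ; at        = mirror ∘ at
  ; at-0      = cong mirror at-0
  ; at-len    = cong mirror at-len
  ; adjacent  = Adj-mirror ∘ adjacent
  ; injective = λ {i} {j} i≤len j≤len eq → injective i≤len j≤len (mirror-injective eq)
  ; vertices  = λ r → mk⇔
      (λ Amr → let (i , i≤len , at-i≡mr) = Equivalence.to (vertices (mirror r)) Amr
               in i , i≤len , trans (cong mirror at-i≡mr) (mirror-involutive r))
      (λ (i , i≤len , mat-i≡r) → Equivalence.from (vertices (mirror r))
               (i , i≤len , trans (sym (mirror-involutive (at i))) (cong mirror mat-i≡r)))
  }
  where
  open IndexedPath path

path-resp-⇔ : ∀ {A B p q} → (∀ r → A r ⇔ B r) → IndexedPath A p q → IndexedPath B p q
path-resp-⇔ A⇔B path = record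
  { len = len ; at = at ; at-0 = at-0 ; at-len = at-len ; adjacent = adjacent ; injective = injective
  ; vertices = λ r → ⇔-trans (⇔-sym (A⇔B r)) (vertices r) }
  where open IndexedPath path

path-endpoints : ∀ {A p q} → IndexedPath A p q → A p × A q
path-endpoints path = Equivalence.from (vertices _) (0 , z≤n , at-0) , Equivalence.from (vertices _) (len , ℕ.≤-refl , at-len)
  where open IndexedPath path

path-cast : ∀ {A p q p′ q′} → p ≡ p′ → q ≡ q′ → IndexedPath A p q → IndexedPath A p′ q′
path-cast refl refl path = path

-- The derived segments

≡⇒⇔ : ∀ {a} {A B : Set a} → A ≡ B → A ⇔ B
≡⇒⇔ refl = mk⇔ (λ x → x) (λ x → x)

module Segments {ℓ : Level} {_≺_ : Rel ℤ ℓ} (sto : IsStrictTotalOrder _≡_ _≺_) where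
  open Ranking sto
  open Derived sto using (Sup; S; walk; step) renaming (n to steps; k to rise)

  -- The walk of Derived visits a point of coordinate sum (sum p + j) at step j,
  -- so bit p q j is its j-th decision (true = up).
  bit : Point → Point → ℕ → Bool
  bit p q j = does (top? (rise p q) (range (sum p) (steps p q)) (sum p + + j))

  staircase : Point → Point → ℕ → Point
  staircase p q = stairs p (bit p q)

  walk≡staircase : ∀ p q i → walk p q i ≡ staircase p q i
  walk≡staircase p q zero    = refl
  walk≡staircase p q (suc i) = trans (cong (step p q) (walk≡staircase p q i))
    (cong (λ b → if b then up w else right w)
          (cong₂ (λ I t → does (top? (rise p q) I t)) (map-upTo _ (steps p q)) (sum-stairs p (bit p q) i)))
    where w = staircase p q i

  Sup⇔staircase : ∀ p q r → Sup p q r ⇔ (∃[ i ] (i ℕ.≤ steps p q × staircase p q i ≡ r))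
  Sup⇔staircase p q r = mk⇔ (λ (i , i≤n , w≡r) → i , i≤n , trans (sym (walk≡staircase p q i)) w≡r)
                            (λ (i , i≤n , w≡r) → i , i≤n , trans (walk≡staircase p q i) w≡r)

  steps-⊞ : ∀ p i j → steps p (p ⊞ (i , j)) ≡ i ℕ.+ j
  steps-⊞ p i j = trans (cong (λ z → ∣ z - sum p ∣) (sum-⊞ p i j)) (∣[x+m]-x∣≡m (sum p) (i ℕ.+ j))

  rise-⊞ : ∀ p i j → rise p (p ⊞ (i , j)) ≡ j
  rise-⊞ p i j = ∣[x+m]-x∣≡m (proj₂ p) j

  steps-stairs : ∀ s f {i j} → i ℕ.≤ j → steps (stairs s f i) (stairs s f j) ≡ j ℕ.∸ i
  steps-stairs s f {i} {j} i≤j =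
    trans (cong₂ (λ u v → ∣ u - v ∣) (sum-stairs s f j) (sum-stairs s f i)) (∣[x+m]-[x+k]∣≡m∸k (sum s) i≤j)

  rise-stairs : ∀ s f {i j} → i ℕ.≤ j → rise (stairs s f i) (stairs s f j) ≡ ups f j ℕ.∸ ups f i
  rise-stairs s f {i} {j} i≤j =
    trans (cong₂ (λ u v → ∣ proj₂ u - proj₂ v ∣) (stairs-⊞ s f j) (stairs-⊞ s f i))
          (∣[x+m]-[x+k]∣≡m∸k (proj₂ s) (ups-mono f i≤j))

  module Staircase (p : Point) (dx dy : ℕ) where
    q = p ⊞ (dx , dy)
    n = dx ℕ.+ dy
    a = sum p
    I = range a n
    f = bit p q
    W = staircase p q

    bit≡top : ∀ j → f j ≡ does (top? dy I (a + + j))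
    bit≡top j = cong₂ (λ K m → does (top? K (range a m) (a + + j))) (rise-⊞ p dx dy) (steps-⊞ p dx dy)

    ups≡count : ∀ i → ups f i ≡ count (top? dy I) (range a i)
    ups≡count i = trans (ups-cong bit≡top i) (ups-count (top? dy I) a i)

    ups-end : ups f n ≡ dy
    ups-end = trans (ups≡count n)
      (count-Top I (range-unique a n) (subst (dy ℕ.≤_) (sym (length-range a n)) (ℕ.m≤n+m dy dx)))

    rights-end : rights f n ≡ dx
    rights-end = ℕ.+-cancelʳ-≡ dy _ _ (trans (cong (rights f n ℕ.+_) (sym ups-end)) (rights+ups f n))

    staircase-end : W n ≡ q
    staircase-end = trans (stairs-⊞ p f n) (cong₂ (λ i j → p ⊞ (i , j)) rights-end ups-end)

    Sup⇔W : ∀ r → Sup p q r ⇔ (∃[ i ] (i ℕ.≤ n × W i ≡ r))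
    Sup⇔W r = subst (λ m → Sup p q r ⇔ (∃[ i ] (i ℕ.≤ m × W i ≡ r))) (steps-⊞ p dx dy) (Sup⇔staircase p q r)

    Sup-staircase : ∀ {i} → i ℕ.≤ n → Sup p q (W i)
    Sup-staircase {i} i≤n = Equivalence.from (Sup⇔W (W i)) (i , i≤n , refl)

    Sup-sum : ∀ {r} → Sup p q r → ∃[ i ] (i ℕ.≤ n × sum r ≡ a + + i)
    Sup-sum {r} Sup-r with Equivalence.to (Sup⇔W r) Sup-r
    ... | i , i≤n , refl = i , i≤n , sum-stairs p f i

    staircase-box : ∀ {i} → i ℕ.≤ n → p ≼ W i × W i ≼ q
    staircase-box {i} i≤n rewrite stairs-⊞ p f i =
      ≼-⊞ p _ , ⊞-mono-≼ p (subst (rights f i ℕ.≤_) rights-end (rights-mono f i≤n))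
                           (subst (ups f i ℕ.≤_) ups-end (ups-mono f i≤n))

    Sup-box : ∀ {r} → Sup p q r → p ≼ r × r ≼ q
    Sup-box {r} Sup-r with Equivalence.to (Sup⇔W r) Sup-r
    ... | i , i≤n , refl = staircase-box i≤n

    module _ {i j} (i≤j : i ℕ.≤ j) where
      J = range (a + + i) (j ℕ.∸ i)

      ups-difference : ups f j ℕ.∸ ups f i ≡ count (top? dy I) J
      ups-difference = begin
        ups f j ℕ.∸ ups f i                       ≡⟨ cong₂ ℕ._∸_ (ups≡count j) (ups≡count i) ⟩
        c (range a j) ℕ.∸ c (range a i)           ≡⟨ cong (λ m → c (range a m) ℕ.∸ c (range a i)) (ℕ.m+[n∸m]≡n i≤j) ⟨
        c (range a (i ℕ.+ (j ℕ.∸ i))) ℕ.∸ c (range a i)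
          ≡⟨ cong (λ xs → c xs ℕ.∸ c (range a i)) (range-++ a i (j ℕ.∸ i)) ⟩
        c (range a i ++ J) ℕ.∸ c (range a i)      ≡⟨ cong (ℕ._∸ c (range a i)) (count-++ (top? dy I) (range a i) J) ⟩
        c (range a i) ℕ.+ c J ℕ.∸ c (range a i)   ≡⟨ ℕ.m+n∸m≡n (c (range a i)) (c J) ⟩
        c J                                       ∎
        where
        c = count (top? dy I)

      bit-staircase : ∀ {l} → l ℕ.< j ℕ.∸ i → bit (W i) (W j) l ≡ f (i ℕ.+ l)
      bit-staircase {l} l<d = begin
        bit (W i) (W j) l
          ≡⟨ cong₂ (λ K m → does (top? K (range (sum (W i)) m) (sum (W i) + + l)))
                   (trans (rise-stairs p f i≤j) ups-difference) (steps-stairs p f i≤j) ⟩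
        does (top? (count (top? dy I) J) (range (sum (W i)) (j ℕ.∸ i)) (sum (W i) + + l))
          ≡⟨ cong (λ b → does (top? (count (top? dy I) J) (range b (j ℕ.∸ i)) (b + + l))) (sum-stairs p f i) ⟩
        does (top? (count (top? dy I) J) J ((a + + i) + + l))
          ≡⟨ does-⇔ (Top-restrict dy I J (∈-range (a + + i) l<d)) (top? _ J _) (top? dy I _) ⟩
        does (top? dy I ((a + + i) + + l))           ≡⟨ cong (does ∘ top? dy I) (+-+-assoc a i l) ⟩
        does (top? dy I (a + + (i ℕ.+ l)))           ≡⟨ bit≡top (i ℕ.+ l) ⟨
        f (i ℕ.+ l)                                   ∎

      sub-staircase : j ℕ.≤ n → ∀ {r} → Sup (W i) (W j) r → Sup p q r
      sub-staircase j≤n {r} Sup-r with Equivalence.to (Sup⇔staircase (W i) (W j) r) Sup-r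
      ... | l , l≤steps , refl =
        subst (Sup p q) (sym (stairs-shift p f (bit (W i) (W j)) i l (λ k<l → bit-staircase (ℕ.<-≤-trans k<l l≤d))))
          (Sup-staircase (ℕ.≤-trans (ℕ.+-monoʳ-≤ i l≤d) (subst (ℕ._≤ n) (sym (ℕ.m+[n∸m]≡n i≤j)) j≤n)))
        where
        l≤d : l ℕ.≤ j ℕ.∸ i
        l≤d = subst (l ℕ.≤_) (steps-stairs p f i≤j) l≤steps

    prefix-closed : ∀ {r x} → Sup p q r → Sup p r x → Sup p q x
    prefix-closed {r} Sup-r with Equivalence.to (Sup⇔W r) Sup-r
    ... | i , i≤n , refl = sub-staircase z≤n i≤n

    suffix-closed : ∀ {r x} → Sup p q r → Sup r q x → Sup p q x
    suffix-closed {r} {x} Sup-r with Equivalence.to (Sup⇔W r) Sup-r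
    ... | i , i≤n , refl = sub-staircase i≤n ℕ.≤-refl ∘ subst (λ t → Sup (W i) t x) (sym staircase-end)

    ∉-beyond-end : ∀ {r m} → n ℕ.< m → sum r ≡ a + + m → ¬ Sup p q r
    ∉-beyond-end n<m sum≡ Sup-r with Sup-sum Sup-r
    ... | i , i≤n , sum≡′ = ℕ.<⇒≱ n<m (subst (ℕ._≤ n) (x+m≡x+k⇒m≡k a (trans (sym sum≡′) sum≡)) i≤n)

    ∉-before-start : ∀ {r} → a ≡ sum r + + 1 → ¬ Sup p q r
    ∉-before-start {r} a≡ Sup-r with Sup-sum Sup-r
    ... | i , _ , sum≡ = contradiction (x≡x+m⇒m≡0 (sum r) (trans sum≡ (trans (cong (_+ + i) a≡) (+-+-assoc (sum r) 1 i)))) λ ()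

    path : IndexedPath (Sup p q) p q
    path = record
      { len       = n
      ; at        = W
      ; at-0      = refl
      ; at-len    = staircase-end
      ; adjacent  = λ _ → stairs-adjacent p f _
      ; injective = λ _ _ → stairs-injective p f
      ; vertices  = Sup⇔W
      }

  forward-extension-⊞ : ∀ p dx dy → let q = p ⊞ (dx , dy) in ∃[ r ] (p ≼ r × Sup p r q × ¬ Sup p q r)
  forward-extension-⊞ p dx dy with Top-suc⊎¬Top dy (range (sum p) (suc (dx ℕ.+ dy))) (sum p + + (dx ℕ.+ dy))
  ... | inj₁ top = p ⊞ (dx , suc dy) , ≼-⊞ p _ , subst (Sup p _) (up-injective up-W≡up-q) (N₁.Sup-staircase n≤n₁) ,
                   ∉-beyond-end (ℕ.≤-reflexive n≡n₁) (sum-⊞ p dx (suc dy))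
    where
    open Staircase p dx dy
    module N₁ = Staircase p dx (suc dy)
    n≡n₁ : suc n ≡ N₁.n
    n≡n₁ = sym (ℕ.+-suc dx dy)
    n≤n₁ : n ℕ.≤ N₁.n
    n≤n₁ = subst (n ℕ.≤_) n≡n₁ (ℕ.n≤1+n n)
    up-W≡up-q : up (N₁.W n) ≡ up q
    up-W≡up-q = begin
      up (N₁.W n)       ≡⟨ stairs-up p N₁.f (trans (N₁.bit≡top n)
                             (trans (cong (λ m → does (top? (suc dy) (range a m) (a + + n))) (sym n≡n₁))
                                    (dec-true (top? (suc dy) (range a (suc n)) (a + + n)) top))) ⟨
      N₁.W (suc n)      ≡⟨ cong N₁.W n≡n₁ ⟩
      N₁.W N₁.n         ≡⟨ N₁.staircase-end ⟩
      p ⊞ (dx , suc dy) ≡⟨ up-⊞ p dx dy ⟨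
      up q              ∎
  ... | inj₂ ¬top = p ⊞ (suc dx , dy) , ≼-⊞ p _ , subst (Sup p _) (right-injective right-W≡right-q) (N₂.Sup-staircase (ℕ.n≤1+n n)) ,
                    ∉-beyond-end ℕ.≤-refl (sum-⊞ p (suc dx) dy)
    where
    open Staircase p dx dy
    module N₂ = Staircase p (suc dx) dy
    right-W≡right-q : right (N₂.W n) ≡ right q
    right-W≡right-q = begin
      right (N₂.W n)    ≡⟨ stairs-right p N₂.f (trans (N₂.bit≡top n) (dec-false (top? dy (range a (suc n)) (a + + n)) ¬top)) ⟨
      N₂.W (suc n)      ≡⟨ N₂.staircase-end ⟩
      p ⊞ (suc dx , dy) ≡⟨ right-⊞ p dx dy ⟨
      right q           ∎

  backward-extension-⊞ : ∀ p dx dy → let q = p ⊞ (dx , dy) in ∃[ r ] (r ≼ q × Sup r q p × ¬ Sup p q r)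
  backward-extension-⊞ p dx dy with Top-suc⊎¬Top dy (range (sum (down p)) (suc (dx ℕ.+ dy))) (sum (down p) + + 0)
  ... | inj₁ top = down p , subst (down p ≼_) (down-⊞ p dx dy) (≼-⊞ (down p) _) ,
                   subst₂ (Sup (down p)) (down-⊞ p dx dy) W₁≡p (N₁.Sup-staircase 1≤n₁) ,
                   ∉-before-start (trans (cong sum (sym (up-down p))) (sum-up (down p)))
    where
    open Staircase p dx dy
    module N₁ = Staircase (down p) dx (suc dy)
    b = sum (down p)
    1≤n₁ : 1 ℕ.≤ N₁.n
    1≤n₁ = ℕ.≤-trans (s≤s z≤n) (ℕ.m≤n+m (suc dy) dx)
    W₁≡p : N₁.W 1 ≡ p
    W₁≡p = trans (stairs-up (down p) N₁.f (trans (N₁.bit≡top 0)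
             (trans (cong (λ m → does (top? (suc dy) (range b m) (b + + 0))) (ℕ.+-suc dx dy))
                    (dec-true (top? (suc dy) (range b (suc n)) (b + + 0)) top))))
           (up-down p)
  ... | inj₂ ¬top = left p , subst (left p ≼_) (left-⊞ p dx dy) (≼-⊞ (left p) _) ,
                    subst₂ (Sup (left p)) (left-⊞ p dx dy) W₂≡p (N₂.Sup-staircase (s≤s z≤n)) ,
                    ∉-before-start (trans (cong sum (sym (right-left p))) (sum-right (left p)))
    where
    open Staircase p dx dy
    module N₂ = Staircase (left p) (suc dx) dy
    W₂≡p : N₂.W 1 ≡ p
    W₂≡p = trans (stairs-right (left p) N₂.f (trans (N₂.bit≡top 0)
             (trans (cong (λ b → does (top? dy (range b (suc n)) (b + + 0))) (sym (sum-down≡sum-left p)))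
                    (dec-false (top? dy (range (sum (down p)) (suc n)) (sum (down p) + + 0)) ¬top))))
           (right-left p)

  Sup-path : ∀ {p q} → p ≼ q → IndexedPath (Sup p q) p q
  Sup-path p≼q with ≼⇒≡⊞ p≼q
  ... | (dx , dy) , refl = Staircase.path _ dx dy

  Sup-box : ∀ {p q r} → p ≼ q → Sup p q r → p ≼ r × r ≼ q
  Sup-box p≼q with ≼⇒≡⊞ p≼q
  ... | (dx , dy) , refl = Staircase.Sup-box _ dx dy

  prefix-closed : ∀ {p q r x} → p ≼ q → Sup p q r → Sup p r x → Sup p q x
  prefix-closed p≼q with ≼⇒≡⊞ p≼q
  ... | (dx , dy) , refl = Staircase.prefix-closed _ dx dy

  suffix-closed : ∀ {p q r x} → p ≼ q → Sup p q r → Sup r q x → Sup p q x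
  suffix-closed p≼q with ≼⇒≡⊞ p≼q
  ... | (dx , dy) , refl = Staircase.suffix-closed _ dx dy

  forward-extension : ∀ {p q} → p ≼ q → ∃[ r ] (p ≼ r × Sup p r q × ¬ Sup p q r)
  forward-extension p≼q with ≼⇒≡⊞ p≼q
  ... | (dx , dy) , refl = forward-extension-⊞ _ dx dy

  backward-extension : ∀ {p q} → p ≼ q → ∃[ r ] (r ≼ q × Sup r q p × ¬ Sup p q r)
  backward-extension p≼q with ≼⇒≡⊞ p≼q
  ... | (dx , dy) , refl = backward-extension-⊞ _ dx dy

  vertical-segment : ∀ p dy r → Sup p (p ⊞ (0 , dy)) r ⇔ (∃[ l ] (l ℕ.≤ dy × r ≡ p ⊞ (0 , l)))
  vertical-segment p dy r = ⇔-trans (Sup⇔W r) (mk⇔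
    (λ (l , l≤dy , W≡r) → l , l≤dy , trans (sym W≡r) (W≡ l≤dy))
    (λ (l , l≤dy , r≡) → l , l≤dy , trans (W≡ l≤dy) (sym r≡)))
    where
    open Staircase p 0 dy
    W≡ : ∀ {l} → l ℕ.≤ dy → W l ≡ p ⊞ (0 , l)
    W≡ {l} l≤dy = trans (stairs-⊞ p f l) (cong₂ (λ i j → p ⊞ (i , j)) rights≡0 ups≡l)
      where
      ups≡l : ups f l ≡ l
      ups≡l = unit-steps⇒≡id (ups f) refl (ups-step f) ups-end l≤dy
      rights≡0 : rights f l ≡ 0
      rights≡0 = ℕ.+-cancelʳ-≡ l _ _ (trans (cong (rights f l ℕ.+_) (sym ups≡l)) (rights+ups f l))

  horizontal-segment : ∀ p dx r → Sup p (p ⊞ (dx , 0)) r ⇔ (∃[ l ] ∃[ l′ ] (l ℕ.+ l′ ≡ dx × r ≡ p ⊞ (l , 0)))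
  horizontal-segment p dx r = ⇔-trans (Sup⇔W r) (mk⇔
    (λ (l , l≤n , W≡r) → l , n ℕ.∸ l , trans (ℕ.m+[n∸m]≡n l≤n) (ℕ.+-identityʳ dx) , trans (sym W≡r) (W≡ l≤n))
    (λ (l , l′ , l+l′≡dx , r≡) → let l≤n = subst (l ℕ.≤_) (sym (trans (ℕ.+-identityʳ dx) (sym l+l′≡dx))) (ℕ.m≤m+n l l′)
                                 in l , l≤n , trans (W≡ l≤n) (sym r≡)))
    where
    open Staircase p dx 0
    W≡ : ∀ {l} → l ℕ.≤ n → W l ≡ p ⊞ (l , 0)
    W≡ {l} l≤n = trans (stairs-⊞ p f l) (cong₂ (λ i j → p ⊞ (i , j)) rights≡l ups≡0)
      where
      rights≡l : rights f l ≡ l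
      rights≡l = unit-steps⇒≡id (rights f) refl (rights-step f) (trans rights-end (sym (ℕ.+-identityʳ dx))) l≤n
      ups≡0 : ups f l ≡ 0
      ups≡0 = ℕ.+-cancelˡ-≡ l _ _ (trans (cong (ℕ._+ ups f l) (sym rights≡l)) (trans (rights+ups f l) (sym (ℕ.+-identityʳ l))))

  -- Derived.S picks one of four formulas by comparing coordinates with ≤, so for
  -- axis-parallel segments two formulas compete; these two lemmas say they agree.
  vertical-mirror : ∀ {p q} → p ≼ q → proj₁ p ≡ proj₁ q → ∀ r → Sup p q r ⇔ Sup (mirror p) (mirror q) (mirror r)
  vertical-mirror {p} p≼q x≡x′ r with ≼⇒≡⊞ p≼q
  ... | (dx , dy) , refl with x≡x+m⇒m≡0 _ x≡x′
  ... | refl = ⇔-trans (vertical-segment p dy r) (⇔-trans mirrored (⇔-sym mirrored-segment))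
    where
    Vertical : Point → Point → Set
    Vertical s t = ∃[ l ] (l ℕ.≤ dy × t ≡ s ⊞ (0 , l))
    mirrored : Vertical p r ⇔ Vertical (mirror p) (mirror r)
    mirrored = mk⇔
      (λ (l , l≤dy , r≡) → l , l≤dy , trans (cong mirror r≡) (mirror-⊞-vertical p l))
      (λ (l , l≤dy , mr≡) → l , l≤dy , mirror-injective (trans mr≡ (sym (mirror-⊞-vertical p l))))
    mirrored-segment : Sup (mirror p) (mirror (p ⊞ (0 , dy))) (mirror r) ⇔ Vertical (mirror p) (mirror r)
    mirrored-segment = subst (λ t → Sup (mirror p) t (mirror r) ⇔ Vertical (mirror p) (mirror r))
      (sym (mirror-⊞-vertical p dy)) (vertical-segment (mirror p) dy (mirror r))

  horizontal-mirror : ∀ {p q} → p ≼ q → proj₂ p ≡ proj₂ q → ∀ r → Sup p q r ⇔ Sup (mirror q) (mirror p) (mirror r)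
  horizontal-mirror {p} p≼q y≡y′ r with ≼⇒≡⊞ p≼q
  ... | (dx , dy) , refl with x≡x+m⇒m≡0 _ y≡y′
  ... | refl = ⇔-trans (horizontal-segment p dx r) (⇔-trans mirrored (⇔-sym mirrored-segment))
    where
    q′ = mirror (p ⊞ (dx , 0))
    Horizontal : Point → Point → Set
    Horizontal s t = ∃[ l ] ∃[ l′ ] (l ℕ.+ l′ ≡ dx × t ≡ s ⊞ (l , 0))
    mirrored : Horizontal p r ⇔ Horizontal q′ (mirror r)
    mirrored = mk⇔
      (λ (l , l′ , l+l′≡dx , r≡) → l′ , l , trans (ℕ.+-comm l′ l) l+l′≡dx ,
         trans (cong mirror r≡) (mirror-⊞-horizontal p (trans (ℕ.+-comm l′ l) l+l′≡dx)))
      (λ (l′ , l , l′+l≡dx , mr≡) → l , l′ , trans (ℕ.+-comm l l′) l′+l≡dx ,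
         mirror-injective (trans mr≡ (sym (mirror-⊞-horizontal p l′+l≡dx))))
    q′⊞dx≡mp : q′ ⊞ (dx , 0) ≡ mirror p
    q′⊞dx≡mp = sym (trans (cong mirror (sym (⊞-identityʳ p))) (mirror-⊞-horizontal p (ℕ.+-identityʳ dx)))
    mirrored-segment : Sup q′ (mirror p) (mirror r) ⇔ Horizontal q′ (mirror r)
    mirrored-segment = subst (λ t → Sup q′ t (mirror r) ⇔ Horizontal q′ (mirror r)) q′⊞dx≡mp
      (horizontal-segment q′ dx (mirror r))

  S-≤-≤ : ∀ {p q r} → proj₁ p ℤ.≤ proj₁ q → proj₂ p ℤ.≤ proj₂ q → S p q r ≡ Sup p q r
  S-≤-≤ {p} {q} px≤qx py≤qy
    rewrite dec-true (proj₁ p ℤ.≤? proj₁ q) px≤qx | dec-true (proj₂ p ℤ.≤? proj₂ q) py≤qy = refl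

  S-≤-≰ : ∀ {p q r} → proj₁ p ℤ.≤ proj₁ q → ¬ proj₂ p ℤ.≤ proj₂ q → S p q r ≡ Sup (mirror q) (mirror p) (mirror r)
  S-≤-≰ {p} {q} px≤qx py≰qy
    rewrite dec-true (proj₁ p ℤ.≤? proj₁ q) px≤qx | dec-false (proj₂ p ℤ.≤? proj₂ q) py≰qy = refl

  S-≰-≤ : ∀ {p q r} → ¬ proj₁ p ℤ.≤ proj₁ q → proj₂ q ℤ.≤ proj₂ p → S p q r ≡ Sup q p r
  S-≰-≤ {p} {q} px≰qx qy≤py
    rewrite dec-false (proj₁ p ℤ.≤? proj₁ q) px≰qx | dec-true (proj₂ q ℤ.≤? proj₂ p) qy≤py = refl

  S-≰-≰ : ∀ {p q r} → ¬ proj₁ p ℤ.≤ proj₁ q → ¬ proj₂ q ℤ.≤ proj₂ p → S p q r ≡ Sup (mirror p) (mirror q) (mirror r)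
  S-≰-≰ {p} {q} px≰qx qy≰py
    rewrite dec-false (proj₁ p ℤ.≤? proj₁ q) px≰qx | dec-false (proj₂ q ℤ.≤? proj₂ p) qy≰py = refl

  S-↗ : ∀ {p q} → p ≼ q → ∀ r → S p q r ⇔ Sup p q r
  S-↗ (px≤qx , py≤qy) r = ≡⇒⇔ (S-≤-≤ px≤qx py≤qy)

  S-↙ : ∀ {p q} → q ≼ p → ∀ r → S p q r ⇔ Sup q p r
  S-↙ {p} {q} q≼p@(qx≤px , qy≤py) r = cases (proj₁ p ℤ.≤? proj₁ q) (proj₂ p ℤ.≤? proj₂ q)
    where
    cases : Dec (proj₁ p ℤ.≤ proj₁ q) → Dec (proj₂ p ℤ.≤ proj₂ q) → S p q r ⇔ Sup q p r
    cases (no px≰qx)  _           = ≡⇒⇔ (S-≰-≤ px≰qx qy≤py)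
    cases (yes px≤qx) (yes py≤qy) = ≡⇒⇔ (trans (S-≤-≤ px≤qx py≤qy) (cong₂ (λ u v → Sup u v r) p≡q (sym p≡q)))
      where
      p≡q : p ≡ q
      p≡q = cong₂ _,_ (ℤ.≤-antisym px≤qx qx≤px) (ℤ.≤-antisym py≤qy qy≤py)
    cases (yes px≤qx) (no py≰qy)  =
      ⇔-trans (≡⇒⇔ (S-≤-≰ px≤qx py≰qy)) (⇔-sym (vertical-mirror q≼p (ℤ.≤-antisym qx≤px px≤qx) r))

  S-↖ : ∀ {p q} → mirror p ≼ mirror q → ∀ r → S p q r ⇔ Sup (mirror p) (mirror q) (mirror r)
  S-↖ {p} {q} (-px≤-qx , py≤qy) r = cases (proj₁ p ℤ.≤? proj₁ q) (proj₂ q ℤ.≤? proj₂ p)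
    where
    qx≤px = ℤ.neg-cancel-≤ -px≤-qx
    cases : Dec (proj₁ p ℤ.≤ proj₁ q) → Dec (proj₂ q ℤ.≤ proj₂ p) → S p q r ⇔ Sup (mirror p) (mirror q) (mirror r)
    cases (yes px≤qx) _           =
      ⇔-trans (≡⇒⇔ (S-≤-≤ px≤qx py≤qy)) (vertical-mirror (px≤qx , py≤qy) (ℤ.≤-antisym px≤qx qx≤px) r)
    cases (no px≰qx)  (yes qy≤py) =
      ⇔-trans (≡⇒⇔ (S-≰-≤ px≰qx qy≤py)) (horizontal-mirror (qx≤px , qy≤py) (ℤ.≤-antisym qy≤py py≤qy) r)
    cases (no px≰qx)  (no qy≰py)  = ≡⇒⇔ (S-≰-≰ px≰qx qy≰py)

  S-↘ : ∀ {p q} → mirror q ≼ mirror p → ∀ r → S p q r ⇔ Sup (mirror q) (mirror p) (mirror r)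
  S-↘ {p} {q} (-qx≤-px , qy≤py) r = cases (proj₂ p ℤ.≤? proj₂ q)
    where
    px≤qx = ℤ.neg-cancel-≤ -qx≤-px
    cases : Dec (proj₂ p ℤ.≤ proj₂ q) → S p q r ⇔ Sup (mirror q) (mirror p) (mirror r)
    cases (yes py≤qy) =
      ⇔-trans (≡⇒⇔ (S-≤-≤ px≤qx py≤qy)) (horizontal-mirror (px≤qx , py≤qy) (ℤ.≤-antisym py≤qy qy≤py) r)
    cases (no py≰qy)  = ≡⇒⇔ (S-≤-≰ px≤qx py≰qy)

  S-sym : ∀ p q r → S p q r ⇔ S q p r
  S-sym p q r with orientation p q
  ... | ↗ h = ⇔-trans (S-↗ h r) (⇔-sym (S-↙ h r))
  ... | ↙ h = ⇔-trans (S-↙ h r) (⇔-sym (S-↗ h r))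
  ... | ↖ h = ⇔-trans (S-↖ h r) (⇔-sym (S-↘ h r))
  ... | ↘ h = ⇔-trans (S-↘ h r) (⇔-sym (S-↖ h r))

  S-path : ∀ p q → IndexedPath (S p q) p q
  S-path p q with orientation p q
  ... | ↗ h = path-resp-⇔ (λ r → ⇔-sym (S-↗ h r)) (Sup-path h)
  ... | ↙ h = path-resp-⇔ (λ r → ⇔-sym (S-↙ h r)) (reverse-path (Sup-path h))
  ... | ↖ h = path-resp-⇔ (λ r → ⇔-sym (S-↖ h r))
                (path-cast (mirror-involutive p) (mirror-involutive q) (mirror-path (Sup-path h)))
  ... | ↘ h = path-resp-⇔ (λ r → ⇔-sym (S-↘ h r))
                (path-cast (mirror-involutive p) (mirror-involutive q) (mirror-path (reverse-path (Sup-path h))))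

  S-box : ∀ p q r → S p q r → Between (proj₁ p) (proj₁ q) (proj₁ r) × Between (proj₂ p) (proj₂ q) (proj₂ r)
  S-box p q r Spqr with orientation p q
  ... | ↗ h = let ((px≤rx , py≤ry) , (rx≤qx , ry≤qy)) = Sup-box h (Equivalence.to (S-↗ h r) Spqr)
              in inj₁ (px≤rx , rx≤qx) , inj₁ (py≤ry , ry≤qy)
  ... | ↙ h = let ((qx≤rx , qy≤ry) , (rx≤px , ry≤py)) = Sup-box h (Equivalence.to (S-↙ h r) Spqr)
              in inj₂ (qx≤rx , rx≤px) , inj₂ (qy≤ry , ry≤py)
  ... | ↖ h = let ((px≤rx , py≤ry) , (rx≤qx , ry≤qy)) = Sup-box h (Equivalence.to (S-↖ h r) Spqr)
              in Between-neg (inj₁ (px≤rx , rx≤qx)) , inj₁ (py≤ry , ry≤qy)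
  ... | ↘ h = let ((qx≤rx , qy≤ry) , (rx≤px , ry≤py)) = Sup-box h (Equivalence.to (S-↘ h r) Spqr)
              in Between-neg (inj₂ (qx≤rx , rx≤px)) , inj₂ (qy≤ry , ry≤py)

  S-consistent : ∀ p q r → S p q r → ∀ {x} → S p r x → S p q x
  S-consistent p q r Spqr {x} with orientation p q
  ... | ↗ h = Equivalence.from (S-↗ h x) ∘ prefix-closed h Sup-r ∘ Equivalence.to (S-↗ (proj₁ (Sup-box h Sup-r)) x)
    where Sup-r = Equivalence.to (S-↗ h r) Spqr
  ... | ↙ h = Equivalence.from (S-↙ h x) ∘ suffix-closed h Sup-r ∘ Equivalence.to (S-↙ (proj₂ (Sup-box h Sup-r)) x)
    where Sup-r = Equivalence.to (S-↙ h r) Spqr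
  ... | ↖ h = Equivalence.from (S-↖ h x) ∘ prefix-closed h Sup-r ∘ Equivalence.to (S-↖ (proj₁ (Sup-box h Sup-r)) x)
    where Sup-r = Equivalence.to (S-↖ h r) Spqr
  ... | ↘ h = Equivalence.from (S-↘ h x) ∘ suffix-closed h Sup-r ∘ Equivalence.to (S-↘ (proj₂ (Sup-box h Sup-r)) x)
    where Sup-r = Equivalence.to (S-↘ h r) Spqr

  S-extendable : ∀ p q → ∃[ r ] (¬ S p q r × S p q ⊆ S p r)
  S-extendable p q with orientation p q
  ... | ↗ h with forward-extension h
  ...   | r , p≼r , Sup-q , ∉ = r , ∉ ∘ Equivalence.to (S-↗ h r) ,
          λ {x} → Equivalence.from (S-↗ p≼r x) ∘ prefix-closed p≼r Sup-q ∘ Equivalence.to (S-↗ h x)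
  S-extendable p q | ↙ h with backward-extension h
  ...   | r , r≼p , Sup-q , ∉ = r , ∉ ∘ Equivalence.to (S-↙ h r) ,
          λ {x} → Equivalence.from (S-↙ r≼p x) ∘ suffix-closed r≼p Sup-q ∘ Equivalence.to (S-↙ h x)
  S-extendable p q | ↖ h with forward-extension h
  ...   | r , mp≼r , Sup-q , ∉ = mirror r ,
          (λ s → ∉ (subst (Sup (mirror p) (mirror q)) (mirror-involutive r) (Equivalence.to (S-↖ h (mirror r)) s))) ,
          λ {x} → Equivalence.from (S-↖ (subst (mirror p ≼_) (sym (mirror-involutive r)) mp≼r) x)
                ∘ subst (λ t → Sup (mirror p) t (mirror x)) (sym (mirror-involutive r))
                ∘ prefix-closed mp≼r Sup-q ∘ Equivalence.to (S-↖ h x)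
  S-extendable p q | ↘ h with backward-extension h
  ...   | r , r≼mp , Sup-q , ∉ = mirror r ,
          (λ s → ∉ (subst (Sup (mirror q) (mirror p)) (mirror-involutive r) (Equivalence.to (S-↘ h (mirror r)) s))) ,
          λ {x} → Equivalence.from (S-↘ (subst (_≼ mirror p) (sym (mirror-involutive r)) r≼mp) x)
                ∘ subst (λ t → Sup t (mirror p) (mirror x)) (sym (mirror-involutive r))
                ∘ suffix-closed r≼mp Sup-q ∘ Equivalence.to (S-↘ h x)

theorem3 : {ℓ : Level} {_≺_ : Rel ℤ ℓ} (sto : IsStrictTotalOrder _≡_ _≺_) →
    IsCDS (Derived.S sto)
theorem3 sto = record
  { S0 = λ p q → path-endpoints (S-path p q)
  ; S1 = λ p q → IndexedPath⇒IsPathVertexSet (S-path p q)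
  ; S2 = S-sym
  ; S3 = S-consistent
  ; S4 = S-extendable
  ; S5 = λ p q → (λ x≡ r Spqr → Between-≡ (proj₁ (S-box p q r Spqr)) x≡)
               , (λ y≡ r Spqr → Between-≡ (proj₂ (S-box p q r Spqr)) y≡)
  }
  where open Segments sto
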